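{- Let $d\ge1$ and let $S_1,\ldots,S_d$ be numerical semigroups different from $\mathbb{N}$. Let $S=\mathrm{Axis}(S_1,\ldots,S_d)=\mathbb{N}^d\setminus\bigcup_{i=1}^d\{h\mathbf{e}_i:h\in\operatorname{H}(S_i)\}$. Define $F_1=\bigcup_{i=1}^d\{n\mathbf{e}_i: n \text{ a minimal generator of } S_i\}$, $F_2=\{\mathbf{e}_i+h\mathbf{e}_j: 2\le h\le\operatorname{m}(S_j),\ i,j\in\{1,\ldots,d\},\ i\ne j\}$, $F_3=\{\mathbf{e}_i+\mathbf{e}_j: 1\le i<j\le d\}$, $F_4=\{\mathbf{e}_i+\mathbf{e}_j+\mathbf{e}_k: 1\le i<j<k\le d\}$ (empty if $d\le 2$). Then $F_1\cup F_2\cup F_3\cup F_4$ is the minimal system of generators of $S$; in particular $$\operatorname{e}(S)=\sum_{i=1}^d\operatorname{e}(S_i)+(d-1)\sum_{i=1}^d(\operatorname{m}(S_i)-1)+\binom{d}{2}+\binom{d}{3},$$ with the convention $\binom{d}{3}=0$ for $d<3$.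
   Context: $\mathbb{N}$ is the set of non-negative integers; $\mathbf{e}_i$ are the standard basis vectors of $\mathbb{R}^d$. A numerical semigroup is a submonoid of $\mathbb{N}$ with finite complement $\operatorname{H}(\cdot)$; $\operatorname{m}(S_i)=\min(S_i\setminus\{0\})$. For a GNS (submonoid of $\mathbb{N}^d$ with finite complement), $\operatorname{e}$ denotes the cardinality of its unique finite minimal system of generators. -}

module Defs where

open import Data.Nat using (ℕ; zero; suc; _+_; _*_; _≤_; _<_)
open import Data.Fin as Fin using (Fin)
open import Data.Vec using (Vec; replicate; zipWith; map; _[_]≔_; lookup)
open import Data.List using (List)
open import Data.List.Membership.Propositional using (_∈_)
open import Data.List.Relation.Unary.Unique.Propositional using (Unique)
open import Data.Product using (Σ; ∃; ∃-syntax; _×_)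
open import Relation.Nullary using (¬_)
open import Relation.Binary.PropositionalEquality using (_≡_)

record IsNumericalSemigroup (S : ℕ → Set) : Set where
  field
    zero∈   : S 0
    +-closed : ∀ {a b} → S a → S b → S (a + b)
    cofinite : ∃[ N ] (∀ n → N ≤ n → S n)

IsMultiplicity : (ℕ → Set) → ℕ → Set
IsMultiplicity S m = (0 < m) × S m × (∀ n → 0 < n → S n → m ≤ n)

_⊕_ : ∀ {d} → Vec ℕ d → Vec ℕ d → Vec ℕ d
_⊕_ = zipWith _+_

infixl 6 _⊕_
infixl 7 _·_

_·_ : ∀ {d} → ℕ → Vec ℕ d → Vec ℕ d
h · v = map (h *_) v

𝟎 : ∀ {d} → Vec ℕ d
𝟎 = replicate _ 0

𝐞 : ∀ {d} → Fin d → Vec ℕ d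
𝐞 i = 𝟎 [ i ]≔ 1

record IsGNS (d : ℕ) (S : Vec ℕ d → Set) : Set where
  field
    zero∈    : S 𝟎
    +-closed : ∀ {a b} → S a → S b → S (a ⊕ b)
    cofinite : ∃[ N ] (∀ x → (∃[ i ] N ≤ lookup x i) → S x)

module Generation {A : Set} (_∙_ : A → A → A) (ε : A) where

  data ⟨_⟩ (G : A → Set) : A → Set where
    nil  : ⟨ G ⟩ ε
    cons : ∀ {g x} → G g → ⟨ G ⟩ x → ⟨ G ⟩ (g ∙ x)

  Generates : (G S : A → Set) → Set
  Generates G S = (∀ x → S x → ⟨ G ⟩ x) × (∀ x → ⟨ G ⟩ x → S x)

  IsMinimalSystemOfGenerators : (G S : A → Set) → Set₁
  IsMinimalSystemOfGenerators G S =
    Generates G S ×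
    (∀ (H : A → Set) → (∀ x → H x → G x) → Generates H S → ∀ x → G x → H x)

-- a duplicate-free list L enumerating the set G (so |G| = length L)
Enumerates : {A : Set} → List A → (A → Set) → Set
Enumerates L G = Unique L × (∀ x → G x → x ∈ L) × (∀ x → x ∈ L → G x)

module GenN = Generation {ℕ} _+_ 0
module GenV (d : ℕ) = Generation {Vec ℕ d} _⊕_ 𝟎

Axis : ∀ {d} → (Fin d → ℕ → Set) → Vec ℕ d → Set
Axis {d} S x = ¬ (∃[ i ] ∃[ h ] (¬ S i h × x ≡ h · 𝐞 i))

F₁ : ∀ {d} → (Fin d → ℕ → Set) → Vec ℕ d → Set
F₁ {d} G x = ∃[ i ] ∃[ n ] (G i n × x ≡ n · 𝐞 i)

F₂ : ∀ {d} → (Fin d → ℕ) → Vec ℕ d → Set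
F₂ {d} m x = ∃[ i ] ∃[ j ] ∃[ h ]
  (¬ i ≡ j × 2 ≤ h × h ≤ m j × x ≡ 𝐞 i ⊕ h · 𝐞 j)

F₃ : ∀ {d} → Vec ℕ d → Set
F₃ {d} x = ∃[ i ] ∃[ j ] (i Fin.< j × x ≡ 𝐞 {d} i ⊕ 𝐞 j)

F₄ : ∀ {d} → Vec ℕ d → Set
F₄ {d} x = ∃[ i ] ∃[ j ] ∃[ k ] (i Fin.< j × j Fin.< k × x ≡ 𝐞 {d} i ⊕ 𝐞 j ⊕ 𝐞 k)

-- In a submonoid of ℕ^d every nonzero element is a sum of irreducible ones (induct on the
-- size ∣x∣, the sum of the coordinates), so its unique minimal system of generators is its
-- set of irreducible elements.  It therefore suffices to show that the irreducibles of
-- Axis(S₁,…,S_d) are exactly F₁ ∪ F₂ ∪ F₃ ∪ F₄, and to count these four disjoint families.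
--
-- Every nonzero element of Axis has size at least 2, since 1 ∉ Sᵢ; hence elements of size
-- at most 3 (F₃, F₄) are irreducible.  In a splitting of eᵢ + h eⱼ one summand has no
-- i-component, so it lies on the j-axis and has size at least m(Sⱼ) ≥ h, leaving size ≤ 1
-- for the other.  Splittings of n eᵢ are splittings of n in Sᵢ.  Conversely, an element
-- with two nonzero coordinates i, j is eᵢ + eⱼ + y; it splits off eᵢ + eⱼ unless y lies on
-- an axis, and the few remaining shapes are either in F or split off m(Sⱼ) eⱼ or eᵢ + eₖ.

module Submission where

open import Defs
open import Algebra.Bundles using (CommutativeSemigroup)
open import Data.Empty using (⊥-elim)
open import Data.Fin as Fin using (Fin; zero; suc)
import Data.Fin.Properties as FP
open import Data.List using (List; []; _∷_; length; map; allFin; _++_; concatMap; applyUpTo)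
open import Data.List.Membership.Propositional using (_∈_; find; lose)
open import Data.List.Membership.Propositional.Properties
  using (∈-map⁺; ∈-map⁻; ∈-allFin; ∈-concatMap⁺; ∈-concatMap⁻; ∈-applyUpTo⁺; ∈-applyUpTo⁻; ∈-++⁺ˡ; ∈-++⁺ʳ; ∈-++⁻)
open import Data.List.Membership.Propositional.Properties.WithK using (unique∧set⇒bag)
import Data.List.Properties as LP
open import Data.List.Relation.Binary.BagAndSetEquality using (∼bag⇒↭)
open import Data.List.Relation.Binary.Disjoint.Propositional using (Disjoint)
open import Data.List.Relation.Binary.Permutation.Propositional.Properties using (↭-length)
import Data.List.Relation.Unary.All as All
open import Data.List.Relation.Unary.Any using (Any; any?; here; there)
open import Data.List.Relation.Unary.Unique.Propositional using (Unique; []; _∷_)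
import Data.List.Relation.Unary.Unique.Propositional.Properties as UP
open import Data.Nat using (ℕ; zero; suc; pred; _+_; _*_; _∸_; _≤_; _<_; z≤n; s≤s; z<s; _≤?_; ≢-nonZero)
open import Data.Nat.Combinatorics using (_C_; nC1≡n; nCk+nC[k+1]≡[n+1]C[k+1])
open import Data.Nat.Induction using (<-wellFounded; <-rec)
open import Data.Nat.ListAction using (sum)
open import Data.Nat.Properties
open import Algebra.Properties.CommutativeSemigroup +-commutativeSemigroup
  using () renaming (interchange to +-interchange)
open import Data.Product using (∃₂; ∃-syntax; _×_; _,_; proj₁; proj₂)
open import Data.Sum as Sum using (_⊎_; inj₁; inj₂)
open import Data.Vec as V using (Vec; []; _∷_; lookup; _[_]%=_)
import Data.Vec.Properties as VP
open import Function using (_∘_; id; case_of_)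
open import Function.Bundles using (mk⇔)
import Induction.WellFounded as WF
open import Level using (0ℓ)
import Relation.Binary.Construct.On as On
open import Relation.Binary.Definitions using (DecidableEquality; tri<; tri≈; tri>)
open import Relation.Binary.PropositionalEquality
open import Relation.Nullary using (¬_; Dec; yes; no; ¬?; _×-dec_)
import Relation.Nullary.Decidable as Dec
open import Relation.Nullary.Decidable using (decidable-stable)

module MonoidGeneration {A : Set} (_∙_ : A → A → A) (ε : A)
  (∙-assoc : ∀ x y z → (x ∙ y) ∙ z ≡ x ∙ (y ∙ z))
  (∙-identityˡ : ∀ x → ε ∙ x ≡ x) (∙-identityʳ : ∀ x → x ∙ ε ≡ x)
  (_≟_ : DecidableEquality A) where

  open Generation _∙_ ε

  ⟨⟩-∙ : ∀ {G x y} → ⟨ G ⟩ x → ⟨ G ⟩ y → ⟨ G ⟩ (x ∙ y)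
  ⟨⟩-∙ {G} {y = y} nil q = subst ⟨ G ⟩ (sym (∙-identityˡ y)) q
  ⟨⟩-∙ {G} {y = y} (cons {g} {x} p r) q = subst ⟨ G ⟩ (sym (∙-assoc g x y)) (cons p (⟨⟩-∙ r q))

  ⟨⟩-singleton : ∀ {G g} → G g → ⟨ G ⟩ g
  ⟨⟩-singleton {G} {g} p = subst ⟨ G ⟩ (∙-identityʳ g) (cons p nil)

  ⟨⟩-mono : ∀ {G H : A → Set} → (∀ {x} → G x → H x) → ∀ {x} → ⟨ G ⟩ x → ⟨ H ⟩ x
  ⟨⟩-mono G⊆H nil        = nil
  ⟨⟩-mono G⊆H (cons p r) = cons (G⊆H p) (⟨⟩-mono G⊆H r)

  ⟨⟩-⊆ : ∀ {G S : A → Set} → S ε → (∀ {a b} → S a → S b → S (a ∙ b)) → (∀ {g} → G g → S g) →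
         ∀ {x} → ⟨ G ⟩ x → S x
  ⟨⟩-⊆ sε ∙-closed G⊆S nil        = sε
  ⟨⟩-⊆ sε ∙-closed G⊆S (cons p r) = ∙-closed (G⊆S p) (⟨⟩-⊆ sε ∙-closed G⊆S r)

  Reducible : (A → Set) → A → Set
  Reducible S x = ∃₂ λ a b → S a × S b × a ≢ ε × b ≢ ε × a ∙ b ≡ x

  Irreducible : (A → Set) → A → Set
  Irreducible S x = ¬ Reducible S x

  generator-or-reducible : ∀ {G S} → Generates G S → ∀ {x} → ⟨ G ⟩ x → x ≢ ε → G x ⊎ Reducible S x
  generator-or-reducible gens nil ε≢ε = ⊥-elim (ε≢ε refl)
  generator-or-reducible {G} {S} gens (cons {g} {y} p r) x≢ε with y ≟ ε | g ≟ ε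
  ... | yes refl | _        = inj₁ (subst G (sym (∙-identityʳ g)) p)
  ... | no y≢ε   | yes refl =
    subst (λ z → G z ⊎ Reducible S z) (sym (∙-identityˡ y)) (generator-or-reducible gens r y≢ε)
  ... | no y≢ε   | no g≢ε   =
    inj₂ (g , y , proj₂ gens g (⟨⟩-singleton p) , proj₂ gens y r , g≢ε , y≢ε , refl)

  irreducible-generator : ∀ {H S} → Generates H S → ∀ {x} → S x → x ≢ ε → Irreducible S x → H x
  irreducible-generator gens sx x≢ε irr with generator-or-reducible gens (proj₁ gens _ sx) x≢ε
  ... | inj₁ hx  = hx
  ... | inj₂ red = ⊥-elim (irr red)

  minimal-generator-≢ε : ∀ {G S} → IsMinimalSystemOfGenerators G S → ∀ {x} → G x → x ≢ ε
  minimal-generator-≢ε {G} {S} (gens , minimal) {x} gx = proj₂ (minimal H (λ _ → proj₁) (H-gens , H⇒S) x gx)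
    where
    H : A → Set
    H y = G y × y ≢ ε
    drop-ε : ∀ {y} → ⟨ G ⟩ y → ⟨ H ⟩ y
    drop-ε nil = nil
    drop-ε (cons {g} {y} p r) with g ≟ ε
    ... | yes refl = subst ⟨ H ⟩ (sym (∙-identityˡ y)) (drop-ε r)
    ... | no g≢ε   = cons (p , g≢ε) (drop-ε r)
    H-gens : ∀ y → S y → ⟨ H ⟩ y
    H-gens y sy = drop-ε (proj₁ gens y sy)
    H⇒S : ∀ y → ⟨ H ⟩ y → S y
    H⇒S y hy = proj₂ gens y (⟨⟩-mono proj₁ hy)

  generators-included : ∀ {F S} → Generates F S → ∀ {x} → F x → S x
  generators-included gens {x} fx = proj₂ gens x (⟨⟩-singleton fx)

  irreducibles-minimal : ∀ {F S} → Generates F S → (∀ {x} → F x → x ≢ ε × Irreducible S x) →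
                         IsMinimalSystemOfGenerators F S
  irreducibles-minimal gens atom = gens , λ H _ H-gens x fx →
    irreducible-generator H-gens (generators-included gens fx) (proj₁ (atom fx)) (proj₂ (atom fx))

  minimal-systems-unique : ∀ {F S} → Generates F S → (∀ {x} → F x → x ≢ ε × Irreducible S x) →
                           ∀ {G′} → IsMinimalSystemOfGenerators G′ S →
                           (∀ x → F x → G′ x) × (∀ x → G′ x → F x)
  minimal-systems-unique {F} {S} gens atom {G′} (gens′ , minimal′) = F⊆G′ , G′⊆F
    where
    F⊆G′ : ∀ x → F x → G′ x
    F⊆G′ x fx =
      irreducible-generator gens′ (generators-included gens fx) (proj₁ (atom fx)) (proj₂ (atom fx))
    G′∩F : A → Set
    G′∩F x = G′ x × F x
    G′∩F-gens : Generates G′∩F S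
    G′∩F-gens = (λ x sx → ⟨⟩-mono (λ {y} fy → F⊆G′ y fy , fy) (proj₁ gens x sx))
              , (λ x hx → proj₂ gens x (⟨⟩-mono proj₂ hx))
    G′⊆F : ∀ x → G′ x → F x
    G′⊆F x g′x = proj₂ (minimal′ G′∩F (λ _ → proj₁) G′∩F-gens x g′x)

  module BySize (size : A → ℕ) (size-∙ : ∀ a b → size (a ∙ b) ≡ size a + size b)
    (size-≢ε : ∀ {a} → a ≢ ε → 0 < size a) where

    size-rec : (P : A → Set) → (∀ x → (∀ y → size y < size x → P y) → P x) → ∀ x → P x
    size-rec P step = WF.All.wfRec (On.wellFounded size <-wellFounded) _ P (λ x rec → step x (λ y → rec))

    size-<ˡ : ∀ a {b} → b ≢ ε → size a < size (a ∙ b)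
    size-<ˡ a {b} b≢ε = subst (size a <_) (sym (size-∙ a b)) (m<m+n (size a) (size-≢ε b≢ε))

    size-<ʳ : ∀ {a} b → a ≢ ε → size b < size (a ∙ b)
    size-<ʳ {a} b a≢ε = subst (size b <_) (sym (size-∙ a b)) (m<n+m (size b) (size-≢ε a≢ε))

    ⟨⟩-by-decomposition : ∀ {F S} → S ε → (∀ {x} → S x → x ≢ ε → F x ⊎ Reducible S x) →
                          ∀ x → S x → ⟨ F ⟩ x
    ⟨⟩-by-decomposition {F} {S} sε decompose = size-rec (λ x → S x → ⟨ F ⟩ x) step
      where
      step : ∀ x → (∀ y → size y < size x → S y → ⟨ F ⟩ y) → S x → ⟨ F ⟩ x
      step x rec sx with x ≟ ε
      ... | yes refl = nil
      ... | no x≢ε with decompose sx x≢ε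
      ...   | inj₁ fx = ⟨⟩-singleton fx
      ...   | inj₂ (a , b , sa , sb , a≢ε , b≢ε , refl) =
        ⟨⟩-∙ (rec a (size-<ˡ a b≢ε) sa) (rec b (size-<ʳ b a≢ε) sb)

    ⟨⟩-replace : ∀ {G H : A → Set} {bound} → (∀ {g} → G g → size g ≤ bound → ⟨ H ⟩ g) →
                 ∀ {x} → size x ≤ bound → ⟨ G ⟩ x → ⟨ H ⟩ x
    ⟨⟩-replace replace x≤ nil = nil
    ⟨⟩-replace {bound = bound} replace x≤ (cons {g} {y} p r) =
      ⟨⟩-∙ (replace p (≤-trans (m≤m+n (size g) (size y)) g+y≤))
           (⟨⟩-replace replace (≤-trans (m≤n+m (size y) (size g)) g+y≤) r)
      where
      g+y≤ : size g + size y ≤ bound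
      g+y≤ = subst (_≤ bound) (size-∙ g y) x≤

    minimal-generator-irreducible : ∀ {G S} → IsMinimalSystemOfGenerators G S →
                                    ∀ {n} → G n → Irreducible S n
    minimal-generator-irreducible {G} {S} (gens , minimal) {n} gn (a , b , sa , sb , a≢ε , b≢ε , refl) =
      proj₂ (minimal H (λ _ → proj₁) (H-gens , H⇒S) n gn) refl
      where
      H : A → Set
      H y = G y × y ≢ n
      H⇒S : ∀ y → ⟨ H ⟩ y → S y
      H⇒S y hy = proj₂ gens y (⟨⟩-mono proj₁ hy)
      H-gens : ∀ y → S y → ⟨ H ⟩ y
      H-gens = size-rec (λ y → S y → ⟨ H ⟩ y) λ y rec sy → ⟨⟩-replace (replace y rec) ≤-refl (proj₁ gens y sy)
        where
        -- the only generator missing from H is n = a ∙ b, and a, b are smaller than n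
        replace : ∀ y → (∀ z → size z < size y → S z → ⟨ H ⟩ z) → ∀ {g} → G g → size g ≤ size y → ⟨ H ⟩ g
        replace y rec {g} gg g≤y with g ≟ n
        ... | no g≢n  = ⟨⟩-singleton (gg , g≢n)
        ... | yes refl = ⟨⟩-∙ (rec a (<-≤-trans (size-<ˡ a b≢ε) g≤y) sa) (rec b (<-≤-trans (size-<ʳ b a≢ε) g≤y) sb)

module ℕ-Generation = MonoidGeneration _+_ 0 +-assoc +-identityˡ +-identityʳ _≟_
module ℕ-BySize = ℕ-Generation.BySize id (λ _ _ → refl) n≢0⇒n>0

open GenN using (⟨_⟩; nil; cons)

1∉ : ∀ {S} → IsNumericalSemigroup S → ∃[ n ] ¬ S n → ¬ S 1
1∉ {S} S-ns (n , n∉S) 1∈S = n∉S (everything n)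
  where
  everything : ∀ n → S n
  everything zero    = IsNumericalSemigroup.zero∈ S-ns
  everything (suc n) = IsNumericalSemigroup.+-closed S-ns 1∈S (everything n)

module _ {G : ℕ → Set} {LG : List ℕ} (enum : Enumerates LG G) (G-≢0 : ∀ {g} → G g → g ≢ 0) where

  private
    Peelable : ℕ → ℕ → Set
    Peelable n g = 0 < g × g ≤ n × ⟨ G ⟩ (n ∸ g)

    peel-generator : ∀ {n} → ⟨ G ⟩ n → n ≢ 0 → ∃[ g ] (G g × Peelable n g)
    peel-generator nil 0≢0 = ⊥-elim (0≢0 refl)
    peel-generator (cons {g} {y} gg r) _ =
      g , gg , n≢0⇒n>0 (G-≢0 gg) , m≤m+n g y , subst ⟨ G ⟩ (sym (m+n∸m≡n g y)) r

  ⟨⟩? : ∀ n → Dec (⟨ G ⟩ n)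
  ⟨⟩? = <-rec (λ n → Dec (⟨ G ⟩ n)) step
    where
    step : ∀ n → (∀ {k} → k < n → Dec (⟨ G ⟩ k)) → Dec (⟨ G ⟩ n)
    step zero _ = yes nil
    step (suc n) rec = Dec.map′ unpeel (repeel ∘ (λ d → peel-generator d λ ())) (any? peel? LG)
      where
      peel? : ∀ g → Dec (Peelable (suc n) g)
      peel? zero = no λ ()
      peel? (suc g) with suc g ≤? suc n
      ... | no g≰n = no (g≰n ∘ proj₁ ∘ proj₂)
      ... | yes g≤n = Dec.map′ (λ d → z<s , g≤n , d) (proj₂ ∘ proj₂) (rec (s≤s (m∸n≤m n g)))
      unpeel : Any (Peelable (suc n)) LG → ⟨ G ⟩ (suc n)
      unpeel any with find any
      ... | g , g∈ , _ , g≤n , r = subst ⟨ G ⟩ (m+[n∸m]≡n g≤n) (cons (proj₂ (proj₂ enum) g g∈) r)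
      repeel : ∃[ g ] (G g × Peelable (suc n) g) → Any (Peelable (suc n)) LG
      repeel (g , gg , p) = lose (proj₁ (proj₂ enum) g gg) p

m+n≡1⇒m≡0⊎n≡0 : ∀ m {n} → m + n ≡ 1 → m ≡ 0 ⊎ n ≡ 0
m+n≡1⇒m≡0⊎n≡0 zero    _  = inj₁ refl
m+n≡1⇒m≡0⊎n≡0 (suc m) eq = inj₂ (m+n≡0⇒n≡0 m (suc-injective eq))

m<n∸1⇒2+m≤n : ∀ {m n} → m < n ∸ 1 → 2 + m ≤ n
m<n∸1⇒2+m≤n {n = suc n} m<n = s≤s m<n

module _ {A B : Set} (f : A → List B) where

  ∈-concatMap⁺′ : ∀ {x xs y} → x ∈ xs → y ∈ f x → y ∈ concatMap f xs
  ∈-concatMap⁺′ x∈xs y∈fx = ∈-concatMap⁺ f (lose x∈xs y∈fx)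

  ∈-concatMap⁻′ : ∀ xs {y} → y ∈ concatMap f xs → ∃[ x ] (x ∈ xs × y ∈ f x)
  ∈-concatMap⁻′ xs y∈ = find (∈-concatMap⁻ f y∈)

  concatMap⁺ : ∀ {xs} → Unique xs → (∀ {x} → x ∈ xs → Unique (f x)) →
               (∀ {x y} → x ∈ xs → y ∈ xs → x ≢ y → Disjoint (f x) (f y)) → Unique (concatMap f xs)
  concatMap⁺ {[]}     _            _        _        = []
  concatMap⁺ {x ∷ xs} (x∉xs ∷ xs!) f-unique disjoint =
    UP.++⁺ (f-unique (here refl)) (concatMap⁺ xs! (f-unique ∘ there) (λ p q → disjoint (there p) (there q)))
      λ (v∈fx , v∈rest) → case ∈-concatMap⁻′ xs v∈rest of λ where
        (y , y∈xs , v∈fy) → disjoint (here refl) (there y∈xs) (All.lookup x∉xs y∈xs) (v∈fx , v∈fy)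

  length-concatMap : ∀ xs → length (concatMap f xs) ≡ sum (map (length ∘ f) xs)
  length-concatMap []       = refl
  length-concatMap (x ∷ xs) = trans (LP.length-++ (f x)) (cong (length (f x) +_) (length-concatMap xs))

sum-map-const : ∀ {A : Set} c (xs : List A) → sum (map (λ _ → c) xs) ≡ length xs * c
sum-map-const c []       = refl
sum-map-const c (x ∷ xs) = cong (c +_) (sum-map-const c xs)

sum-map-*ˡ : ∀ {A : Set} c (f : A → ℕ) xs → sum (map (λ x → c * f x) xs) ≡ c * sum (map f xs)
sum-map-*ˡ c f []       = sym (*-zeroʳ c)
sum-map-*ˡ c f (x ∷ xs) = trans (cong (c * f x +_) (sum-map-*ˡ c f xs)) (sym (*-distribˡ-+ c (f x) _))

others : ∀ {n} → Fin n → List (Fin n)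
others {suc n} j = map (Fin.punchIn j) (allFin n)

∈-others⁺ : ∀ {n} {i j : Fin n} → i ≢ j → i ∈ others j
∈-others⁺ {suc n} {i} {j} i≢j =
  subst (_∈ others j) (FP.punchIn-punchOut (i≢j ∘ sym)) (∈-map⁺ (Fin.punchIn j) (∈-allFin _))

∈-others⁻ : ∀ {n} {i j : Fin n} → i ∈ others j → i ≢ j
∈-others⁻ {suc n} {j = j} i∈ with ∈-map⁻ (Fin.punchIn j) i∈
... | k , _ , refl = FP.punchInᵢ≢i j k

others-unique : ∀ {n} (j : Fin n) → Unique (others j)
others-unique {suc n} j = UP.map⁺ (FP.punchIn-injective j _ _) (UP.allFin⁺ n)

length-others : ∀ {n} (j : Fin n) → length (others j) ≡ n ∸ 1
length-others {suc n} j = trans (LP.length-map (Fin.punchIn j) (allFin n)) (LP.length-tabulate id)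

enumerations-length : ∀ {A : Set} {P : A → Set} {xs ys} → Enumerates xs P → Enumerates ys P → length xs ≡ length ys
enumerations-length (xs! , P⊆xs , xs⊆P) (ys! , P⊆ys , ys⊆P) =
  ↭-length (∼bag⇒↭ (unique∧set⇒bag xs! ys! (mk⇔ (P⊆ys _ ∘ xs⊆P _) (P⊆xs _ ∘ ys⊆P _))))

lookup-⊕ : ∀ {d} (x y : Vec ℕ d) t → lookup (x ⊕ y) t ≡ lookup x t + lookup y t
lookup-⊕ x y t = VP.lookup-zipWith _+_ t x y

lookup-· : ∀ {d} h (x : Vec ℕ d) t → lookup (h · x) t ≡ h * lookup x t
lookup-· h x t = VP.lookup-map t (h *_) x

lookup-𝟎 : ∀ {d} (t : Fin d) → lookup 𝟎 t ≡ 0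
lookup-𝟎 t = VP.lookup-replicate t 0

lookup-𝐞-≡ : ∀ {d} (i : Fin d) → lookup (𝐞 i) i ≡ 1
lookup-𝐞-≡ i = VP.lookup∘update i 𝟎 1

lookup-𝐞-≢ : ∀ {d} {t i : Fin d} → t ≢ i → lookup (𝐞 i) t ≡ 0
lookup-𝐞-≢ {t = t} t≢i = trans (VP.lookup∘update′ t≢i 𝟎 1) (lookup-𝟎 t)

lookup-·𝐞-≡ : ∀ {d} h (i : Fin d) → lookup (h · 𝐞 i) i ≡ h
lookup-·𝐞-≡ h i = trans (lookup-· h (𝐞 i) i) (trans (cong (h *_) (lookup-𝐞-≡ i)) (*-identityʳ h))

lookup-·𝐞-≢ : ∀ {d} h {t i : Fin d} → t ≢ i → lookup (h · 𝐞 i) t ≡ 0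
lookup-·𝐞-≢ h {t} {i} t≢i = trans (lookup-· h (𝐞 i) t) (trans (cong (h *_) (lookup-𝐞-≢ t≢i)) (*-zeroʳ h))

lookup-injective : ∀ {d} {x y : Vec ℕ d} → (∀ t → lookup x t ≡ lookup y t) → x ≡ y
lookup-injective {x = x} {y} x≗y =
  trans (sym (VP.tabulate∘lookup x)) (trans (VP.tabulate-cong x≗y) (VP.tabulate∘lookup y))

⊕-assoc : ∀ {d} (x y z : Vec ℕ d) → x ⊕ y ⊕ z ≡ x ⊕ (y ⊕ z)
⊕-assoc = VP.zipWith-assoc +-assoc

⊕-comm : ∀ {d} (x y : Vec ℕ d) → x ⊕ y ≡ y ⊕ x
⊕-comm = VP.zipWith-comm +-comm

⊕-identityˡ : ∀ {d} (x : Vec ℕ d) → 𝟎 ⊕ x ≡ x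
⊕-identityˡ = VP.zipWith-identityˡ +-identityˡ

⊕-identityʳ : ∀ {d} (x : Vec ℕ d) → x ⊕ 𝟎 ≡ x
⊕-identityʳ = VP.zipWith-identityʳ +-identityʳ

⊕-commutativeSemigroup : ℕ → CommutativeSemigroup 0ℓ 0ℓ
⊕-commutativeSemigroup d = record
  { Carrier = Vec ℕ d
  ; _≈_ = _≡_
  ; _∙_ = _⊕_
  ; isCommutativeSemigroup = record
    { isSemigroup = record
      { isMagma = record { isEquivalence = isEquivalence ; ∙-cong = cong₂ _⊕_ }
      ; assoc = ⊕-assoc }
    ; comm = ⊕-comm } }

·-distribʳ : ∀ {d} a b (x : Vec ℕ d) → (a + b) · x ≡ a · x ⊕ b · x
·-distribʳ a b []      = refl
·-distribʳ a b (c ∷ x) = cong₂ _∷_ (*-distribʳ-+ c a b) (·-distribʳ a b x)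

·-suc : ∀ {d} h (x : Vec ℕ d) → suc h · x ≡ x ⊕ h · x
·-suc h []      = refl
·-suc h (c ∷ x) = cong (c + h * c ∷_) (·-suc h x)

·-identityˡ : ∀ {d} (x : Vec ℕ d) → 1 · x ≡ x
·-identityˡ []      = refl
·-identityˡ (c ∷ x) = cong₂ _∷_ (+-identityʳ c) (·-identityˡ x)

∣_∣ : ∀ {d} → Vec ℕ d → ℕ
∣_∣ = V.sum

∣⊕∣ : ∀ {d} (x y : Vec ℕ d) → ∣ x ⊕ y ∣ ≡ ∣ x ∣ + ∣ y ∣
∣⊕∣ []      []      = refl
∣⊕∣ (a ∷ x) (b ∷ y) = trans (cong (a + b +_) (∣⊕∣ x y)) (+-interchange a b ∣ x ∣ ∣ y ∣)

∣·∣ : ∀ {d} h (x : Vec ℕ d) → ∣ h · x ∣ ≡ h * ∣ x ∣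
∣·∣ h []      = sym (*-zeroʳ h)
∣·∣ h (a ∷ x) = trans (cong (h * a +_) (∣·∣ h x)) (sym (*-distribˡ-+ h a ∣ x ∣))

∣𝐞∣ : ∀ {d} (i : Fin d) → ∣ 𝐞 i ∣ ≡ 1
∣𝐞∣ {suc d} zero    = cong suc (∣𝟎∣ d)
  where
  ∣𝟎∣ : ∀ d → ∣ 𝟎 {d} ∣ ≡ 0
  ∣𝟎∣ zero    = refl
  ∣𝟎∣ (suc d) = ∣𝟎∣ d
∣𝐞∣ {suc d} (suc i) = ∣𝐞∣ i

∣·𝐞∣ : ∀ {d} h (i : Fin d) → ∣ h · 𝐞 i ∣ ≡ h
∣·𝐞∣ h i = trans (∣·∣ h (𝐞 i)) (trans (cong (h *_) (∣𝐞∣ i)) (*-identityʳ h))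

∣∣≡0⇒≡𝟎 : ∀ {d} (x : Vec ℕ d) → ∣ x ∣ ≡ 0 → x ≡ 𝟎
∣∣≡0⇒≡𝟎 []      _  = refl
∣∣≡0⇒≡𝟎 (a ∷ x) eq = cong₂ _∷_ (m+n≡0⇒m≡0 a eq) (∣∣≡0⇒≡𝟎 x (m+n≡0⇒n≡0 a eq))

lookup≤∣∣ : ∀ {d} (x : Vec ℕ d) t → lookup x t ≤ ∣ x ∣
lookup≤∣∣ (a ∷ x) zero    = m≤m+n a ∣ x ∣
lookup≤∣∣ (a ∷ x) (suc t) = ≤-trans (lookup≤∣∣ x t) (m≤n+m ∣ x ∣ a)

lookup+lookup≤∣∣ : ∀ {d} (x : Vec ℕ d) {i j} → i ≢ j → lookup x i + lookup x j ≤ ∣ x ∣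
lookup+lookup≤∣∣ (a ∷ x) {zero}  {zero}  i≢j = ⊥-elim (i≢j refl)
lookup+lookup≤∣∣ (a ∷ x) {zero}  {suc j} _   = +-monoʳ-≤ a (lookup≤∣∣ x j)
lookup+lookup≤∣∣ (a ∷ x) {suc i} {zero}  _   = subst (_≤ a + ∣ x ∣) (+-comm a _) (+-monoʳ-≤ a (lookup≤∣∣ x i))
lookup+lookup≤∣∣ (a ∷ x) {suc i} {suc j} i≢j =
  ≤-trans (lookup+lookup≤∣∣ x (i≢j ∘ cong suc)) (m≤n+m ∣ x ∣ a)

on-axis : ∀ {d} (x : Vec ℕ d) i → (∀ t → t ≢ i → lookup x t ≡ 0) → x ≡ lookup x i · 𝐞 i
on-axis x i off-axis = lookup-injective coordinate
  where
  coordinate : ∀ t → lookup x t ≡ lookup (lookup x i · 𝐞 i) t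
  coordinate t with t Fin.≟ i
  ... | yes refl = sym (lookup-·𝐞-≡ _ i)
  ... | no t≢i   = trans (off-axis t t≢i) (sym (lookup-·𝐞-≢ (lookup x i) t≢i))

Spread : ∀ {d} → Vec ℕ d → Set
Spread x = ∃₂ λ i j → i ≢ j × lookup x i ≢ 0 × lookup x j ≢ 0

data Shape {d} (x : Vec ℕ d) : Set where
  null   : x ≡ 𝟎 → Shape x
  axial  : ∀ k → lookup x k ≢ 0 → x ≡ lookup x k · 𝐞 k → Shape x
  spread : Spread x → Shape x

shape : ∀ {d} (x : Vec ℕ d) → Shape x
shape x with FP.any? (λ t → ¬? (lookup x t ≟ 0))
... | no none = null (lookup-injective λ t →
        trans (decidable-stable (lookup x t ≟ 0) (λ xt≢0 → none (t , xt≢0))) (sym (lookup-𝟎 t)))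
... | yes (k , xk≢0) with FP.any? (λ t → ¬? (t Fin.≟ k) ×-dec ¬? (lookup x t ≟ 0))
...   | yes (j , j≢k , xj≢0) = spread (k , j , j≢k ∘ sym , xk≢0 , xj≢0)
...   | no none = axial k xk≢0 (on-axis x k λ t t≢k →
          decidable-stable (lookup x t ≟ 0) (λ xt≢0 → none (t , t≢k , xt≢0)))

peel-𝐞 : ∀ {d} (x : Vec ℕ d) {i} → lookup x i ≢ 0 →
         ∃[ y ] (x ≡ 𝐞 i ⊕ y × ∀ t → t ≢ i → lookup y t ≡ lookup x t)
peel-𝐞 x {i} xi≢0 = x [ i ]%= pred , lookup-injective coordinate , λ t t≢i → VP.lookup∘updateAt′ t i t≢i x
  where
  coordinate : ∀ t → lookup x t ≡ lookup (𝐞 i ⊕ (x [ i ]%= pred)) t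
  coordinate t with t Fin.≟ i
  ... | yes refl = sym (begin
    lookup (𝐞 t ⊕ (x [ t ]%= pred)) t          ≡⟨ lookup-⊕ (𝐞 t) _ t ⟩
    lookup (𝐞 t) t + lookup (x [ t ]%= pred) t ≡⟨ cong₂ _+_ (lookup-𝐞-≡ t) (VP.lookup∘updateAt t x) ⟩
    suc (pred (lookup x t))                   ≡⟨ suc-pred (lookup x t) ⦃ ≢-nonZero xi≢0 ⦄ ⟩
    lookup x t                                ∎)
    where open ≡-Reasoning
  ... | no t≢i = sym (trans (lookup-⊕ (𝐞 i) _ t)
                   (cong₂ _+_ (lookup-𝐞-≢ t≢i) (VP.lookup∘updateAt′ t i t≢i x)))

·𝐞-support : ∀ {d} h {k t : Fin d} → lookup (h · 𝐞 k) t ≢ 0 → t ≡ k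
·𝐞-support h {k} {t} nonzero with t Fin.≟ k
... | yes t≡k = t≡k
... | no t≢k  = ⊥-elim (nonzero (lookup-·𝐞-≢ h t≢k))

·𝐞≢𝟎 : ∀ {d} {h} (i : Fin d) → h ≢ 0 → h · 𝐞 i ≢ 𝟎
·𝐞≢𝟎 {h = h} i h≢0 eq = h≢0 (trans (sym (lookup-·𝐞-≡ h i)) (trans (cong (λ v → lookup v i) eq) (lookup-𝟎 i)))

spread⇒≢𝟎 : ∀ {d} {x : Vec ℕ d} → Spread x → x ≢ 𝟎
spread⇒≢𝟎 (i , _ , _ , xi≢0 , _) refl = xi≢0 (lookup-𝟎 i)

·𝐞-not-spread : ∀ {d} h {k : Fin d} → ¬ Spread (h · 𝐞 k)
·𝐞-not-spread h (i , j , i≢j , xi≢0 , xj≢0) = i≢j (trans (·𝐞-support h xi≢0) (sym (·𝐞-support h xj≢0)))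

spread⇒axis : ∀ {d} {S : Fin d → ℕ → Set} {x} → Spread x → Axis S x
spread⇒axis x-spread (k , h , _ , refl) = ·𝐞-not-spread h x-spread

lookup-⊕-≢0ˡ : ∀ {d} (x y : Vec ℕ d) {t} → lookup x t ≢ 0 → lookup (x ⊕ y) t ≢ 0
lookup-⊕-≢0ˡ x y {t} xt≢0 = xt≢0 ∘ m+n≡0⇒m≡0 _ ∘ trans (sym (lookup-⊕ x y t))

lookup-⊕-≢0ʳ : ∀ {d} (x y : Vec ℕ d) {t} → lookup y t ≢ 0 → lookup (x ⊕ y) t ≢ 0
lookup-⊕-≢0ʳ x y {t} yt≢0 = yt≢0 ∘ m+n≡0⇒n≡0 _ ∘ trans (sym (lookup-⊕ x y t))

spread-⊕ : ∀ {d} {x y : Vec ℕ d} {i j} → i ≢ j → lookup x i ≢ 0 → lookup y j ≢ 0 → Spread (x ⊕ y)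
spread-⊕ {x = x} {y} {i} {j} i≢j xi≢0 yj≢0 = i , j , i≢j , lookup-⊕-≢0ˡ x y xi≢0 , lookup-⊕-≢0ʳ x y yj≢0

spread-⊕ˡ : ∀ {d} {x : Vec ℕ d} y → Spread x → Spread (x ⊕ y)
spread-⊕ˡ {x = x} y (i , j , i≢j , xi≢0 , xj≢0) = i , j , i≢j , lookup-⊕-≢0ˡ x y xi≢0 , lookup-⊕-≢0ˡ x y xj≢0

spread-𝐞⊕·𝐞 : ∀ {d} {i j : Fin d} {h} → i ≢ j → h ≢ 0 → Spread (𝐞 i ⊕ h · 𝐞 j)
spread-𝐞⊕·𝐞 {i = i} {j} {h} i≢j h≢0 =
  spread-⊕ {x = 𝐞 i} {h · 𝐞 j} i≢j (1+n≢0 ∘ trans (sym (lookup-𝐞-≡ i))) (h≢0 ∘ trans (sym (lookup-·𝐞-≡ h j)))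

spread-𝐞⊕𝐞 : ∀ {d} {i j : Fin d} → i ≢ j → Spread (𝐞 i ⊕ 𝐞 j)
spread-𝐞⊕𝐞 {i = i} {j} i≢j = subst (λ v → Spread (𝐞 i ⊕ v)) (·-identityˡ (𝐞 j)) (spread-𝐞⊕·𝐞 {h = 1} i≢j λ ())

module _ {d} {i j : Fin d} (i≢j : i ≢ j) (h : ℕ) where

  lookup-𝐞⊕·𝐞-≡ˡ : lookup (𝐞 i ⊕ h · 𝐞 j) i ≡ 1
  lookup-𝐞⊕·𝐞-≡ˡ = trans (lookup-⊕ (𝐞 i) _ i) (cong₂ _+_ (lookup-𝐞-≡ i) (lookup-·𝐞-≢ h i≢j))

  lookup-𝐞⊕·𝐞-≡ʳ : lookup (𝐞 i ⊕ h · 𝐞 j) j ≡ h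
  lookup-𝐞⊕·𝐞-≡ʳ = trans (lookup-⊕ (𝐞 i) _ j) (cong₂ _+_ (lookup-𝐞-≢ (i≢j ∘ sym)) (lookup-·𝐞-≡ h j))

lookup-𝐞⊕·𝐞-≢ : ∀ {d} {i j t : Fin d} h → t ≢ i → t ≢ j → lookup (𝐞 i ⊕ h · 𝐞 j) t ≡ 0
lookup-𝐞⊕·𝐞-≢ {i = i} {j} {t} h t≢i t≢j =
  trans (lookup-⊕ (𝐞 i) _ t) (cong₂ _+_ (lookup-𝐞-≢ t≢i) (lookup-·𝐞-≢ h t≢j))

lookup-𝐞≤1 : ∀ {d} (i t : Fin d) → lookup (𝐞 i) t ≤ 1
lookup-𝐞≤1 i t with t Fin.≟ i
... | yes refl = ≤-reflexive (lookup-𝐞-≡ i)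
... | no t≢i   = subst (_≤ 1) (sym (lookup-𝐞-≢ t≢i)) z≤n

lookup-⊕𝐞≤1 : ∀ {d} (x : Vec ℕ d) k → (∀ t → lookup x t ≤ 1) → lookup x k ≡ 0 →
              ∀ t → lookup (x ⊕ 𝐞 k) t ≤ 1
lookup-⊕𝐞≤1 x k x≤1 xk≡0 t = subst (_≤ 1) (sym (lookup-⊕ x (𝐞 k) t)) (bound (t Fin.≟ k))
  where
  bound : Dec (t ≡ k) → lookup x t + lookup (𝐞 k) t ≤ 1
  bound (yes refl) = ≤-reflexive (cong₂ _+_ xk≡0 (lookup-𝐞-≡ t))
  bound (no t≢k)   = subst (_≤ 1) (sym (trans (cong (lookup x t +_) (lookup-𝐞-≢ t≢k)) (+-identityʳ _))) (x≤1 t)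

lookup-𝐞⊕𝐞≤1 : ∀ {d} {i j : Fin d} → i ≢ j → ∀ t → lookup (𝐞 i ⊕ 𝐞 j) t ≤ 1
lookup-𝐞⊕𝐞≤1 {i = i} {j} i≢j = lookup-⊕𝐞≤1 (𝐞 i) j (lookup-𝐞≤1 i) (lookup-𝐞-≢ (i≢j ∘ sym))

lookup-𝐞⊕𝐞⊕𝐞≤1 : ∀ {d} {i j k : Fin d} → i ≢ j → k ≢ i → k ≢ j → ∀ t → lookup (𝐞 i ⊕ 𝐞 j ⊕ 𝐞 k) t ≤ 1
lookup-𝐞⊕𝐞⊕𝐞≤1 {i = i} {j} {k} i≢j k≢i k≢j =
  lookup-⊕𝐞≤1 (𝐞 i ⊕ 𝐞 j) k (lookup-𝐞⊕𝐞≤1 i≢j)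
    (trans (lookup-⊕ (𝐞 i) (𝐞 j) k) (cong₂ _+_ (lookup-𝐞-≢ k≢i) (lookup-𝐞-≢ k≢j)))

0·≡𝟎 : ∀ {d} (x : Vec ℕ d) → 0 · x ≡ 𝟎
0·≡𝟎 []      = refl
0·≡𝟎 (_ ∷ x) = cong (0 ∷_) (0·≡𝟎 x)

∣𝐞⊕𝐞∣ : ∀ {d} (i j : Fin d) → ∣ 𝐞 i ⊕ 𝐞 j ∣ ≡ 2
∣𝐞⊕𝐞∣ i j = trans (∣⊕∣ (𝐞 i) (𝐞 j)) (cong₂ _+_ (∣𝐞∣ i) (∣𝐞∣ j))

∣𝐞⊕𝐞⊕𝐞∣ : ∀ {d} (i j k : Fin d) → ∣ 𝐞 i ⊕ 𝐞 j ⊕ 𝐞 k ∣ ≡ 3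
∣𝐞⊕𝐞⊕𝐞∣ i j k = trans (∣⊕∣ (𝐞 i ⊕ 𝐞 j) (𝐞 k)) (cong₂ _+_ (∣𝐞⊕𝐞∣ i j) (∣𝐞∣ k))

∣𝐞⊕·𝐞∣ : ∀ {d} (i j : Fin d) h → ∣ 𝐞 i ⊕ h · 𝐞 j ∣ ≡ suc h
∣𝐞⊕·𝐞∣ i j h = trans (∣⊕∣ (𝐞 i) (h · 𝐞 j)) (cong₂ _+_ (∣𝐞∣ i) (∣·𝐞∣ h j))

lookup-𝐞⊕·𝐞≤1 : ∀ {d} {i j t : Fin d} h → t ≢ j → lookup (𝐞 i ⊕ h · 𝐞 j) t ≤ 1
lookup-𝐞⊕·𝐞≤1 {i = i} {j} {t} h t≢j = subst (_≤ 1) (sym (trans (lookup-⊕ (𝐞 i) _ t)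
  (trans (cong (lookup (𝐞 i) t +_) (lookup-·𝐞-≢ h t≢j)) (+-identityʳ _)))) (lookup-𝐞≤1 i t)

·𝐞-injective : ∀ {d} {h h′} (i : Fin d) → h · 𝐞 i ≡ h′ · 𝐞 i → h ≡ h′
·𝐞-injective {h = h} {h′} i eq =
  trans (sym (lookup-·𝐞-≡ h i)) (trans (cong (λ v → lookup v i) eq) (lookup-·𝐞-≡ h′ i))

𝐞-injective : ∀ {d} {i j : Fin d} → 𝐞 i ≡ 𝐞 j → i ≡ j
𝐞-injective {i = i} {j} eq = decidable-stable (i Fin.≟ j) λ i≢j →
  1+n≢0 (trans (sym (lookup-𝐞-≡ i)) (trans (cong (λ v → lookup v i) eq) (lookup-𝐞-≢ i≢j)))

𝐞⊕·𝐞-injective : ∀ {d} {i j : Fin d} {h h′} → 𝐞 i ⊕ h · 𝐞 j ≡ 𝐞 i ⊕ h′ · 𝐞 j → h ≡ h′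
𝐞⊕·𝐞-injective {i = i} {j} {h} {h′} eq = +-cancelˡ-≡ (lookup (𝐞 i) j) h h′ (begin
  lookup (𝐞 i) j + h            ≡⟨ cong (lookup (𝐞 i) j +_) (lookup-·𝐞-≡ h j) ⟨
  lookup (𝐞 i) j + lookup (h · 𝐞 j) j   ≡⟨ lookup-⊕ (𝐞 i) (h · 𝐞 j) j ⟨
  lookup (𝐞 i ⊕ h · 𝐞 j) j     ≡⟨ cong (λ v → lookup v j) eq ⟩
  lookup (𝐞 i ⊕ h′ · 𝐞 j) j    ≡⟨ lookup-⊕ (𝐞 i) (h′ · 𝐞 j) j ⟩
  lookup (𝐞 i) j + lookup (h′ · 𝐞 j) j  ≡⟨ cong (lookup (𝐞 i) j +_) (lookup-·𝐞-≡ h′ j) ⟩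
  lookup (𝐞 i) j + h′           ∎)
  where open ≡-Reasoning

lookup-summand≤ : ∀ {d} {a b x : Vec ℕ d} → a ⊕ b ≡ x → ∀ t → lookup b t ≤ lookup x t
lookup-summand≤ {a = a} {b} refl t = subst (lookup b t ≤_) (sym (lookup-⊕ a b t)) (m≤n+m _ _)

F₃-𝐞⊕𝐞 : ∀ {d} {i j : Fin d} → i ≢ j → F₃ (𝐞 i ⊕ 𝐞 j)
F₃-𝐞⊕𝐞 {i = i} {j} i≢j with FP.<-cmp i j
... | tri< i<j _ _ = i , j , i<j , refl
... | tri≈ _ i≡j _ = ⊥-elim (i≢j i≡j)
... | tri> _ _ j<i = j , i , j<i , ⊕-comm (𝐞 i) (𝐞 j)

module _ {d : ℕ} where
  open import Algebra.Properties.CommutativeSemigroup (⊕-commutativeSemigroup d)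

  F₄-insert : ∀ {i j k : Fin d} → i Fin.< j → k ≢ i → k ≢ j → F₄ (𝐞 i ⊕ 𝐞 j ⊕ 𝐞 k)
  F₄-insert {i} {j} {k} i<j k≢i k≢j with FP.<-cmp k i | FP.<-cmp k j
  ... | tri< k<i _ _ | _            = k , i , j , k<i , i<j , xy∙z≈zx∙y (𝐞 i) (𝐞 j) (𝐞 k)
  ... | tri≈ _ k≡i _ | _            = ⊥-elim (k≢i k≡i)
  ... | tri> _ _ i<k | tri< k<j _ _ = i , k , j , i<k , k<j , xy∙z≈xz∙y (𝐞 i) (𝐞 j) (𝐞 k)
  ... | tri> _ _ _   | tri≈ _ k≡j _ = ⊥-elim (k≢j k≡j)
  ... | tri> _ _ _   | tri> _ _ j<k = i , j , k , i<j , j<k , refl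

  F₄-𝐞⊕𝐞⊕𝐞 : ∀ {i j k : Fin d} → i ≢ j → k ≢ i → k ≢ j → F₄ (𝐞 i ⊕ 𝐞 j ⊕ 𝐞 k)
  F₄-𝐞⊕𝐞⊕𝐞 {i} {j} {k} i≢j k≢i k≢j with FP.<-cmp i j
  ... | tri< i<j _ _ = F₄-insert i<j k≢i k≢j
  ... | tri≈ _ i≡j _ = ⊥-elim (i≢j i≡j)
  ... | tri> _ _ j<i = subst F₄ (cong (_⊕ 𝐞 k) (⊕-comm (𝐞 j) (𝐞 i))) (F₄-insert j<i k≢j k≢i)

∷-disjoint : ∀ {n} {a b : ℕ} {xs ys : List (Vec ℕ n)} → a ≢ b → Disjoint (map (a ∷_) xs) (map (b ∷_) ys)
∷-disjoint {a = a} {b} a≢b (v∈as , v∈bs) with ∈-map⁻ (a ∷_) v∈as | ∈-map⁻ (b ∷_) v∈bs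
... | _ , _ , refl | _ , _ , eq = a≢b (VP.∷-injectiveˡ eq)

-- In dimension n + 1, eᵢ + eⱼ with i < j is 1 ∷ e_{j-1} if i = 0, and 0 ∷ (e_{i-1} + e_{j-1}) otherwise.
unitPairSums : ∀ n → List (Vec ℕ n)
unitPairSums zero    = []
unitPairSums (suc n) = map (1 ∷_) (map 𝐞 (allFin n)) ++ map (0 ∷_) (unitPairSums n)

unitTripleSums : ∀ n → List (Vec ℕ n)
unitTripleSums zero    = []
unitTripleSums (suc n) = map (1 ∷_) (unitPairSums n) ++ map (0 ∷_) (unitTripleSums n)

∈-unitPairSums⁺ : ∀ {n} {x : Vec ℕ n} → F₃ x → x ∈ unitPairSums n
∈-unitPairSums⁺ {suc n} (zero  , suc j , _         , refl) =
  ∈-++⁺ˡ (subst (_∈ map (1 ∷_) (map 𝐞 (allFin n))) (cong (1 ∷_) (sym (⊕-identityˡ (𝐞 j))))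
                (∈-map⁺ (1 ∷_) (∈-map⁺ 𝐞 (∈-allFin j))))
∈-unitPairSums⁺ {suc n} (suc i , suc j , s≤s i<j , refl) =
  ∈-++⁺ʳ _ (∈-map⁺ (0 ∷_) (∈-unitPairSums⁺ (i , j , i<j , refl)))

∈-unitPairSums⁻ : ∀ {n} {x : Vec ℕ n} → x ∈ unitPairSums n → F₃ x
∈-unitPairSums⁻ {suc n} x∈ with ∈-++⁻ (map (1 ∷_) (map 𝐞 (allFin n))) x∈
... | inj₁ x∈₁ with ∈-map⁻ (1 ∷_) x∈₁
...   | y , y∈ , refl with ∈-map⁻ 𝐞 y∈
...     | j , _ , refl = zero , suc j , z<s , cong (1 ∷_) (sym (⊕-identityˡ (𝐞 j)))
∈-unitPairSums⁻ {suc n} x∈ | inj₂ x∈₂ with ∈-map⁻ (0 ∷_) x∈₂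
...   | y , y∈ , refl with ∈-unitPairSums⁻ y∈
...     | i , j , i<j , refl = suc i , suc j , s≤s i<j , refl

∈-unitTripleSums⁺ : ∀ {n} {x : Vec ℕ n} → F₄ x → x ∈ unitTripleSums n
∈-unitTripleSums⁺ {suc n} (zero  , suc j , suc k , _ , s≤s j<k , refl) =
  ∈-++⁺ˡ (subst (_∈ map (1 ∷_) (unitPairSums n)) (cong (λ v → 1 ∷ v ⊕ 𝐞 k) (sym (⊕-identityˡ (𝐞 j))))
                (∈-map⁺ (1 ∷_) (∈-unitPairSums⁺ (j , k , j<k , refl))))
∈-unitTripleSums⁺ {suc n} (suc i , suc j , suc k , s≤s i<j , s≤s j<k , refl) =
  ∈-++⁺ʳ _ (∈-map⁺ (0 ∷_) (∈-unitTripleSums⁺ (i , j , k , i<j , j<k , refl)))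

∈-unitTripleSums⁻ : ∀ {n} {x : Vec ℕ n} → x ∈ unitTripleSums n → F₄ x
∈-unitTripleSums⁻ {suc n} x∈ with ∈-++⁻ (map (1 ∷_) (unitPairSums n)) x∈
... | inj₁ x∈₁ with ∈-map⁻ (1 ∷_) x∈₁
...   | y , y∈ , refl with ∈-unitPairSums⁻ y∈
...     | j , k , j<k , refl =
  zero , suc j , suc k , z<s , s≤s j<k , cong (λ v → 1 ∷ v ⊕ 𝐞 k) (sym (⊕-identityˡ (𝐞 j)))
∈-unitTripleSums⁻ {suc n} x∈ | inj₂ x∈₂ with ∈-map⁻ (0 ∷_) x∈₂
...   | y , y∈ , refl with ∈-unitTripleSums⁻ y∈
...     | i , j , k , i<j , j<k , refl = suc i , suc j , suc k , s≤s i<j , s≤s j<k , refl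

unitPairSums-unique : ∀ n → Unique (unitPairSums n)
unitPairSums-unique zero    = []
unitPairSums-unique (suc n) =
  UP.++⁺ (UP.map⁺ VP.∷-injectiveʳ (UP.map⁺ 𝐞-injective (UP.allFin⁺ n)))
         (UP.map⁺ VP.∷-injectiveʳ (unitPairSums-unique n)) (∷-disjoint λ ())

unitTripleSums-unique : ∀ n → Unique (unitTripleSums n)
unitTripleSums-unique zero    = []
unitTripleSums-unique (suc n) =
  UP.++⁺ (UP.map⁺ VP.∷-injectiveʳ (unitPairSums-unique n))
         (UP.map⁺ VP.∷-injectiveʳ (unitTripleSums-unique n)) (∷-disjoint λ ())

length-unitPairSums : ∀ n → length (unitPairSums n) ≡ n C 2
length-unitPairSums zero    = refl
length-unitPairSums (suc n) = begin
  length (map (1 ∷_) (map 𝐞 (allFin n)) ++ map (0 ∷_) (unitPairSums n))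
    ≡⟨ LP.length-++ (map (1 ∷_) (map 𝐞 (allFin n))) ⟩
  length (map (1 ∷_) (map 𝐞 (allFin n))) + length (map (0 ∷_) (unitPairSums n))
    ≡⟨ cong₂ _+_ (trans (LP.length-map (1 V.∷_) (map 𝐞 (allFin n)))
                        (trans (LP.length-map 𝐞 (allFin n)) (LP.length-tabulate id)))
                 (trans (LP.length-map (0 V.∷_) (unitPairSums n)) (length-unitPairSums n)) ⟩
  n + n C 2     ≡⟨ cong (_+ n C 2) (nC1≡n n) ⟨
  n C 1 + n C 2 ≡⟨ nCk+nC[k+1]≡[n+1]C[k+1] n 1 ⟩
  suc n C 2     ∎
  where open ≡-Reasoning

length-unitTripleSums : ∀ n → length (unitTripleSums n) ≡ n C 3
length-unitTripleSums zero    = refl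
length-unitTripleSums (suc n) = begin
  length (map (1 ∷_) (unitPairSums n) ++ map (0 ∷_) (unitTripleSums n))
    ≡⟨ LP.length-++ (map (1 ∷_) (unitPairSums n)) ⟩
  length (map (1 ∷_) (unitPairSums n)) + length (map (0 ∷_) (unitTripleSums n))
    ≡⟨ cong₂ _+_ (trans (LP.length-map (1 V.∷_) (unitPairSums n)) (length-unitPairSums n))
                 (trans (LP.length-map (0 V.∷_) (unitTripleSums n)) (length-unitTripleSums n)) ⟩
  n C 2 + n C 3 ≡⟨ nCk+nC[k+1]≡[n+1]C[k+1] n 2 ⟩
  suc n C 3     ∎
  where open ≡-Reasoning

module ⊕-Generation (d : ℕ) = MonoidGeneration {Vec ℕ d} _⊕_ 𝟎 ⊕-assoc ⊕-identityˡ ⊕-identityʳ (VP.≡-dec _≟_)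

module AxisSemigroup {d} (S : Fin d → ℕ → Set) (S-ns : ∀ i → IsNumericalSemigroup (S i))
  (S-proper : ∀ i → ∃[ n ] ¬ S i n) where

  open IsNumericalSemigroup
  open ⊕-Generation d using (Irreducible)

  axis⇒¬¬ : ∀ {i} h → Axis S (h · 𝐞 i) → ¬ ¬ S i h
  axis⇒¬¬ h ax h∉S = ax (_ , h , h∉S , refl)

  ⊕-on-axis : ∀ {a b : Vec ℕ d} {h k} → a ⊕ b ≡ h · 𝐞 k →
              a ≡ lookup a k · 𝐞 k × b ≡ lookup b k · 𝐞 k × lookup a k + lookup b k ≡ h
  ⊕-on-axis {a} {b} {h} {k} eq =
      on-axis a k (λ t t≢k → m+n≡0⇒m≡0 (lookup a t) (at t t≢k))
    , on-axis b k (λ t t≢k → m+n≡0⇒n≡0 (lookup a t) (at t t≢k))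
    , trans (sym (lookup-⊕ a b k)) (trans (cong (λ v → lookup v k) eq) (lookup-·𝐞-≡ h k))
    where
    at : ∀ t → t ≢ k → lookup a t + lookup b t ≡ 0
    at t t≢k = trans (sym (lookup-⊕ a b t)) (trans (cong (λ v → lookup v t) eq) (lookup-·𝐞-≢ h t≢k))

  axis-𝟎 : Axis S 𝟎
  axis-𝟎 (k , h , h∉S , eq) = h∉S (subst (S k) (sym h≡0) (zero∈ (S-ns k)))
    where
    h≡0 : h ≡ 0
    h≡0 = trans (sym (lookup-·𝐞-≡ h k)) (trans (cong (λ v → lookup v k) (sym eq)) (lookup-𝟎 k))

  axis-·𝐞 : ∀ {i h} → S i h → Axis S (h · 𝐞 i)
  axis-·𝐞 {i} {h} h∈S (k , h′ , h′∉S , eq) with k Fin.≟ i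
  ... | yes refl = h′∉S (subst (S k) h≡h′ h∈S)
    where
    h≡h′ : h ≡ h′
    h≡h′ = trans (sym (lookup-·𝐞-≡ h k)) (trans (cong (λ v → lookup v k) eq) (lookup-·𝐞-≡ h′ k))
  ... | no k≢i = h′∉S (subst (S k) 0≡h′ (zero∈ (S-ns k)))
    where
    0≡h′ : 0 ≡ h′
    0≡h′ = trans (sym (lookup-·𝐞-≢ h k≢i)) (trans (cong (λ v → lookup v k) eq) (lookup-·𝐞-≡ h′ k))

  axis-⊕ : ∀ {a b} → Axis S a → Axis S b → Axis S (a ⊕ b)
  axis-⊕ {a} {b} axa axb (k , h , h∉S , eq) with ⊕-on-axis eq
  ... | a≡ , b≡ , ak+bk≡h =
    axis⇒¬¬ (lookup a k) (subst (Axis S) a≡ axa) λ ak∈S →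
    axis⇒¬¬ (lookup b k) (subst (Axis S) b≡ axb) λ bk∈S →
    h∉S (subst (S k) ak+bk≡h (+-closed (S-ns k) ak∈S bk∈S))

  2≤∣∣ : ∀ {a} → Axis S a → a ≢ 𝟎 → 2 ≤ ∣ a ∣
  2≤∣∣ {a} axa a≢𝟎 with shape a
  ... | null a≡𝟎 = ⊥-elim (a≢𝟎 a≡𝟎)
  ... | axial k ak≢0 a≡ =
    subst (2 ≤_) (sym (trans (cong ∣_∣ a≡) (∣·𝐞∣ _ k))) (≤∧≢⇒< (n≢0⇒n>0 ak≢0) (ak≢1 ∘ sym))
    where
    ak≢1 : lookup a k ≢ 1
    ak≢1 ak≡1 = axis⇒¬¬ (lookup a k) (subst (Axis S) a≡ axa) λ ak∈S →
      1∉ (S-ns k) (S-proper k) (subst (S k) ak≡1 ak∈S)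
  ... | spread (i , j , i≢j , ai≢0 , aj≢0) =
    ≤-trans (+-mono-≤ (n≢0⇒n>0 ai≢0) (n≢0⇒n>0 aj≢0)) (lookup+lookup≤∣∣ a i≢j)

  irreducible-if-∣∣≤3 : ∀ {x} → ∣ x ∣ ≤ 3 → Irreducible (Axis S) x
  irreducible-if-∣∣≤3 ∣x∣≤3 (a , b , axa , axb , a≢𝟎 , b≢𝟎 , refl) = <-irrefl refl (begin
    4               ≤⟨ +-mono-≤ (2≤∣∣ axa a≢𝟎) (2≤∣∣ axb b≢𝟎) ⟩
    ∣ a ∣ + ∣ b ∣   ≡⟨ ∣⊕∣ a b ⟨
    ∣ a ⊕ b ∣       ≤⟨ ∣x∣≤3 ⟩
    3               ∎)
    where open ≤-Reasoning

module MinimalSystemOfAxis {d} (S : Fin d → ℕ → Set) (S-ns : ∀ i → IsNumericalSemigroup (S i))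
  (S-proper : ∀ i → ∃[ n ] ¬ S i n) (m : Fin d → ℕ) (m-mult : ∀ i → IsMultiplicity (S i) (m i))
  (G : Fin d → ℕ → Set) (G-min : ∀ i → GenN.IsMinimalSystemOfGenerators (G i) (S i))
  (LG : Fin d → List ℕ) (LG-enum : ∀ i → Enumerates (LG i) (G i)) where

  open AxisSemigroup S S-ns S-proper
  open ⊕-Generation d
  open GenV d using (Generates; IsMinimalSystemOfGenerators)
  open ⊕-Generation.BySize d ∣_∣ ∣⊕∣ (λ {a} a≢𝟎 → n≢0⇒n>0 (a≢𝟎 ∘ ∣∣≡0⇒≡𝟎 a))
  open import Algebra.Properties.CommutativeSemigroup (⊕-commutativeSemigroup d)

  G-≢0 : ∀ {i n} → G i n → n ≢ 0
  G-≢0 {i} = ℕ-Generation.minimal-generator-≢ε (G-min i)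

  S? : ∀ i n → Dec (S i n)
  S? i n = Dec.map′ (proj₂ (proj₁ (G-min i)) n) (proj₁ (proj₁ (G-min i)) n) (⟨⟩? (LG-enum i) G-≢0 n)

  m∈S : ∀ j → S j (m j)
  m∈S j = proj₁ (proj₂ (m-mult j))

  m≤ : ∀ {j n} → n ≢ 0 → S j n → m j ≤ n
  m≤ {j} n≢0 = proj₂ (proj₂ (m-mult j)) _ (n≢0⇒n>0 n≢0)

  -- Axis S only excludes non-members, so membership of the coefficient needs decidability of S i
  on-axis⇒∈ : ∀ {x i} → Axis S x → x ≡ lookup x i · 𝐞 i → x ≢ 𝟎 → S i (lookup x i) × lookup x i ≢ 0
  on-axis⇒∈ {x} {i} ax x≡ x≢𝟎 =
      decidable-stable (S? i _) (axis⇒¬¬ _ (subst (Axis S) x≡ ax))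
    , λ xi≡0 → x≢𝟎 (trans x≡ (trans (cong (_· 𝐞 i) xi≡0) (0·≡𝟎 (𝐞 i))))

  F : Vec ℕ d → Set
  F x = F₁ G x ⊎ F₂ m x ⊎ F₃ x ⊎ F₄ x

  F-spread : ∀ {x} → F₂ m x ⊎ F₃ x ⊎ F₄ x → Spread x
  F-spread (inj₁ (i , j , h , i≢j , 2≤h , _ , refl)) = spread-𝐞⊕·𝐞 {i = i} {j} {h} i≢j (m<n⇒n≢0 2≤h)
  F-spread (inj₂ (inj₁ (i , j , i<j , refl))) = spread-𝐞⊕𝐞 {i = i} {j} (FP.<⇒≢ i<j)
  F-spread (inj₂ (inj₂ (i , j , k , i<j , _ , refl))) = spread-⊕ˡ {x = 𝐞 i ⊕ 𝐞 j} (𝐞 k) (spread-𝐞⊕𝐞 (FP.<⇒≢ i<j))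

  F⇒axis : ∀ {x} → F x → Axis S x
  F⇒axis (inj₁ (i , n , gn , refl)) = axis-·𝐞 (proj₂ (proj₁ (G-min i)) n (ℕ-Generation.⟨⟩-singleton gn))
  F⇒axis (inj₂ f) = spread⇒axis (F-spread f)

  irreducible-·𝐞 : ∀ {i n} → G i n → Irreducible (Axis S) (n · 𝐞 i)
  irreducible-·𝐞 {i} gn (a , b , axa , axb , a≢𝟎 , b≢𝟎 , eq) with ⊕-on-axis eq
  ... | a≡ , b≡ , ai+bi≡n with on-axis⇒∈ axa a≡ a≢𝟎 | on-axis⇒∈ axb b≡ b≢𝟎
  ...   | ai∈S , ai≢0 | bi∈S , bi≢0 =
    ℕ-BySize.minimal-generator-irreducible (G-min i) gn (_ , _ , ai∈S , bi∈S , ai≢0 , bi≢0 , ai+bi≡n)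

  -- b has no i-component, so it lies on the j-th axis and is at least m j ≥ h, leaving ∣ a ∣ ≤ 1
  summand-without-i : ∀ {i j h} → i ≢ j → h ≤ m j → ∀ {a b} → Axis S a → Axis S b → a ≢ 𝟎 → b ≢ 𝟎 →
                      a ⊕ b ≡ 𝐞 i ⊕ h · 𝐞 j → lookup b i ≢ 0
  summand-without-i {i} {j} {h} i≢j h≤m {a} {b} axa axb a≢𝟎 b≢𝟎 eq bi≡0 =
    <-irrefl refl (≤-trans (2≤∣∣ axa a≢𝟎) ∣a∣≤1)
    where
    b≡ : b ≡ lookup b j · 𝐞 j
    b≡ = on-axis b j λ t t≢j → case t Fin.≟ i of λ where
      (yes refl) → bi≡0
      (no t≢i)   → n≤0⇒n≡0 (subst (lookup b t ≤_) (lookup-𝐞⊕·𝐞-≢ h t≢i t≢j) (lookup-summand≤ eq t))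
    h≤∣b∣ : h ≤ ∣ b ∣
    h≤∣b∣ with on-axis⇒∈ axb b≡ b≢𝟎
    ... | bj∈S , bj≢0 = ≤-trans h≤m (subst (m j ≤_) (sym (trans (cong ∣_∣ b≡) (∣·𝐞∣ _ j))) (m≤ bj≢0 bj∈S))
    ∣a∣≤1 : ∣ a ∣ ≤ 1
    ∣a∣≤1 = +-cancelʳ-≤ h ∣ a ∣ 1 (begin
      ∣ a ∣ + h       ≤⟨ +-monoʳ-≤ ∣ a ∣ h≤∣b∣ ⟩
      ∣ a ∣ + ∣ b ∣   ≡⟨ ∣⊕∣ a b ⟨
      ∣ a ⊕ b ∣       ≡⟨ cong ∣_∣ eq ⟩
      ∣ 𝐞 i ⊕ h · 𝐞 j ∣ ≡⟨ ∣𝐞⊕·𝐞∣ i j h ⟩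
      1 + h           ∎)
      where open ≤-Reasoning

  irreducible-𝐞⊕·𝐞 : ∀ {i j h} → i ≢ j → h ≤ m j → Irreducible (Axis S) (𝐞 i ⊕ h · 𝐞 j)
  irreducible-𝐞⊕·𝐞 {i} {j} {h} i≢j h≤m (a , b , axa , axb , a≢𝟎 , b≢𝟎 , eq)
    with m+n≡1⇒m≡0⊎n≡0 (lookup a i)
           (trans (sym (lookup-⊕ a b i)) (trans (cong (λ v → lookup v i) eq) (lookup-𝐞⊕·𝐞-≡ˡ i≢j h)))
  ... | inj₂ bi≡0 = summand-without-i i≢j h≤m axa axb a≢𝟎 b≢𝟎 eq bi≡0
  ... | inj₁ ai≡0 = summand-without-i i≢j h≤m axb axa b≢𝟎 a≢𝟎 (trans (⊕-comm b a) eq) ai≡0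

  F-irreducible : ∀ {x} → F x → x ≢ 𝟎 × Irreducible (Axis S) x
  F-irreducible (inj₁ (i , n , gn , refl)) = ·𝐞≢𝟎 i (G-≢0 gn) , irreducible-·𝐞 gn
  F-irreducible (inj₂ f@(inj₁ (i , j , h , i≢j , _ , h≤m , refl))) =
    spread⇒≢𝟎 (F-spread f) , irreducible-𝐞⊕·𝐞 i≢j h≤m
  F-irreducible (inj₂ f@(inj₂ (inj₁ (i , j , _ , refl)))) =
    spread⇒≢𝟎 (F-spread f) , irreducible-if-∣∣≤3 (m≤n⇒m≤1+n (≤-reflexive (∣𝐞⊕𝐞∣ i j)))
  F-irreducible (inj₂ f@(inj₂ (inj₂ (i , j , k , _ , _ , refl)))) =
    spread⇒≢𝟎 (F-spread f) , irreducible-if-∣∣≤3 (≤-reflexive (∣𝐞⊕𝐞⊕𝐞∣ i j k))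

  F-or-Reducible : Vec ℕ d → Set
  F-or-Reducible x = F x ⊎ Reducible (Axis S) x

  spread-reducible : ∀ {a b} → Spread a → Spread b → Reducible (Axis S) (a ⊕ b)
  spread-reducible sa sb = _ , _ , spread⇒axis sa , spread⇒axis sb , spread⇒≢𝟎 sa , spread⇒≢𝟎 sb , refl

  pair-case : ∀ {i j} h → i ≢ j → h ≢ 0 → F-or-Reducible (𝐞 i ⊕ h · 𝐞 j)
  pair-case zero _ 0≢0 = ⊥-elim (0≢0 refl)
  pair-case {i} {j} 1 i≢j _ =
    inj₁ (inj₂ (inj₂ (inj₁ (subst F₃ (cong (𝐞 i ⊕_) (sym (·-identityˡ (𝐞 j)))) (F₃-𝐞⊕𝐞 i≢j)))))
  pair-case {i} {j} h@(suc (suc _)) i≢j _ with h ≤? m j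
  ... | yes h≤m = inj₁ (inj₂ (inj₁ (i , j , h , i≢j , s≤s (s≤s z≤n) , h≤m , refl)))
  ... | no h≰m  = inj₂ (_ , _ , axis-·𝐞 (m∈S j) , spread⇒axis rest-spread ,
                        ·𝐞≢𝟎 j (m<n⇒n≢0 (proj₁ (m-mult j))) , spread⇒≢𝟎 rest-spread , split)
    where
    m<h : m j < h
    m<h = ≰⇒> h≰m
    rest-spread : Spread (𝐞 i ⊕ (h ∸ m j) · 𝐞 j)
    rest-spread = spread-𝐞⊕·𝐞 i≢j (m<n⇒n≢0 (m<n⇒0<n∸m m<h))
    split : m j · 𝐞 j ⊕ (𝐞 i ⊕ (h ∸ m j) · 𝐞 j) ≡ 𝐞 i ⊕ h · 𝐞 j
    split = begin
      m j · 𝐞 j ⊕ (𝐞 i ⊕ (h ∸ m j) · 𝐞 j)   ≡⟨ x∙yz≈y∙xz (m j · 𝐞 j) (𝐞 i) _ ⟩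
      𝐞 i ⊕ (m j · 𝐞 j ⊕ (h ∸ m j) · 𝐞 j)   ≡⟨ cong (𝐞 i ⊕_) (·-distribʳ (m j) (h ∸ m j) (𝐞 j)) ⟨
      𝐞 i ⊕ (m j + (h ∸ m j)) · 𝐞 j         ≡⟨ cong (λ n → 𝐞 i ⊕ n · 𝐞 j) (m+[n∸m]≡n (<⇒≤ m<h)) ⟩
      𝐞 i ⊕ h · 𝐞 j                         ∎
      where open ≡-Reasoning

  distinct-triple-case : ∀ {i j k} h → i ≢ j → k ≢ i → k ≢ j → h ≢ 0 → F-or-Reducible (𝐞 i ⊕ 𝐞 j ⊕ h · 𝐞 k)
  distinct-triple-case zero _ _ _ 0≢0 = ⊥-elim (0≢0 refl)
  distinct-triple-case {i} {j} {k} 1 i≢j k≢i k≢j _ =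
    inj₁ (inj₂ (inj₂ (inj₂ (subst F₄ (cong (𝐞 i ⊕ 𝐞 j ⊕_) (sym (·-identityˡ (𝐞 k))))
                                  (F₄-𝐞⊕𝐞⊕𝐞 i≢j k≢i k≢j)))))
  distinct-triple-case {i} {j} {k} (suc (suc h)) i≢j k≢i k≢j _ =
    inj₂ (subst (Reducible (Axis S)) regroup
            (spread-reducible (spread-𝐞⊕𝐞 (k≢i ∘ sym)) (spread-𝐞⊕·𝐞 {h = suc h} (k≢j ∘ sym) λ ())))
    where
    regroup : 𝐞 i ⊕ 𝐞 k ⊕ (𝐞 j ⊕ suc h · 𝐞 k) ≡ 𝐞 i ⊕ 𝐞 j ⊕ suc (suc h) · 𝐞 k
    regroup = trans (interchange (𝐞 i) (𝐞 k) (𝐞 j) _) (cong (𝐞 i ⊕ 𝐞 j ⊕_) (sym (·-suc (suc h) (𝐞 k))))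

  triple-case : ∀ {i j k h} → i ≢ j → h ≢ 0 → F-or-Reducible (𝐞 i ⊕ 𝐞 j ⊕ h · 𝐞 k)
  triple-case {i} {j} {k} {h} i≢j h≢0 with k Fin.≟ i | k Fin.≟ j
  ... | yes refl | _ = subst F-or-Reducible (sym regroup) (pair-case (suc h) (i≢j ∘ sym) λ ())
    where
    regroup : 𝐞 k ⊕ 𝐞 j ⊕ h · 𝐞 k ≡ 𝐞 j ⊕ suc h · 𝐞 k
    regroup = trans (xy∙z≈y∙xz (𝐞 k) (𝐞 j) _) (cong (𝐞 j ⊕_) (sym (·-suc h (𝐞 k))))
  ... | no _ | yes refl = subst F-or-Reducible (sym regroup) (pair-case (suc h) i≢j λ ())
    where
    regroup : 𝐞 i ⊕ 𝐞 k ⊕ h · 𝐞 k ≡ 𝐞 i ⊕ suc h · 𝐞 k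
    regroup = trans (⊕-assoc (𝐞 i) (𝐞 k) _) (cong (𝐞 i ⊕_) (sym (·-suc h (𝐞 k))))
  ... | no k≢i | no k≢j = distinct-triple-case h i≢j k≢i k≢j h≢0

  spread-case : ∀ {x} → Spread x → F-or-Reducible x
  spread-case {x} (i , j , i≢j , xi≢0 , xj≢0) with peel-𝐞 x xi≢0
  ... | y , x≡𝐞i⊕y , y≗x with peel-𝐞 y (subst (_≢ 0) (sym (y≗x j (i≢j ∘ sym))) xj≢0)
  ...   | z , y≡𝐞j⊕z , _ = subst F-or-Reducible (sym x≡) (by-shape z (shape z))
    where
    x≡ : x ≡ 𝐞 i ⊕ 𝐞 j ⊕ z
    x≡ = trans x≡𝐞i⊕y (trans (cong (𝐞 i ⊕_) y≡𝐞j⊕z) (sym (⊕-assoc (𝐞 i) (𝐞 j) z)))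
    by-shape : ∀ z → Shape z → F-or-Reducible (𝐞 i ⊕ 𝐞 j ⊕ z)
    by-shape z (null refl)       = inj₁ (inj₂ (inj₂ (inj₁ (subst F₃ (sym (⊕-identityʳ _)) (F₃-𝐞⊕𝐞 i≢j)))))
    by-shape z (axial k zk≢0 z≡) = subst F-or-Reducible (cong (𝐞 i ⊕ 𝐞 j ⊕_) (sym z≡)) (triple-case i≢j zk≢0)
    by-shape z (spread z-spread) = inj₂ (spread-reducible (spread-𝐞⊕𝐞 i≢j) z-spread)

  axis-case : ∀ {k h} → S k h → h ≢ 0 → F-or-Reducible (h · 𝐞 k)
  axis-case {k} {h} h∈S h≢0
    with ℕ-Generation.generator-or-reducible (proj₁ (G-min k)) (proj₁ (proj₁ (G-min k)) h h∈S) h≢0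
  ... | inj₁ gh = inj₁ (inj₁ (k , h , gh , refl))
  ... | inj₂ (a , b , a∈S , b∈S , a≢0 , b≢0 , refl) =
    inj₂ (_ , _ , axis-·𝐞 a∈S , axis-·𝐞 b∈S , ·𝐞≢𝟎 k a≢0 , ·𝐞≢𝟎 k b≢0 , sym (·-distribʳ a b (𝐞 k)))

  F-or-reducible : ∀ {x} → Axis S x → x ≢ 𝟎 → F-or-Reducible x
  F-or-reducible {x} ax x≢𝟎 with shape x
  ... | null x≡𝟎        = ⊥-elim (x≢𝟎 x≡𝟎)
  ... | spread x-spread = spread-case x-spread
  ... | axial k _ x≡ with on-axis⇒∈ ax x≡ x≢𝟎
  ...   | xk∈S , xk≢0 = subst F-or-Reducible (sym x≡) (axis-case xk∈S xk≢0)

  F-generates : Generates F (Axis S)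
  F-generates = ⟨⟩-by-decomposition axis-𝟎 F-or-reducible , λ _ → ⟨⟩-⊆ axis-𝟎 axis-⊕ F⇒axis

  F-minimal : IsMinimalSystemOfGenerators F (Axis S)
  F-minimal = irreducibles-minimal F-generates F-irreducible


  range : Fin d → List ℕ
  range j = applyUpTo (2 +_) (m j ∸ 1)

  ∈-range⁺ : ∀ {j h} → 2 ≤ h → h ≤ m j → h ∈ range j
  ∈-range⁺ {j} 2≤h@(s≤s (s≤s _)) h≤m =
    subst (_∈ range j) (m+[n∸m]≡n 2≤h) (∈-applyUpTo⁺ (2 +_) (∸-monoˡ-≤ 1 h≤m))

  ∈-range⁻ : ∀ {j h} → h ∈ range j → 2 ≤ h × h ≤ m j
  ∈-range⁻ {j} h∈ with ∈-applyUpTo⁻ (2 +_) h∈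
  ... | t , t<m∸1 , refl = s≤s (s≤s z≤n) , m<n∸1⇒2+m≤n t<m∸1

  F₁-list : List (Vec ℕ d)
  F₁-list = concatMap (λ i → map (_· 𝐞 i) (LG i)) (allFin d)

  F₂-block : Fin d → Fin d → List (Vec ℕ d)
  F₂-block j i = map (λ h → 𝐞 i ⊕ h · 𝐞 j) (range j)

  F₂-row : Fin d → List (Vec ℕ d)
  F₂-row j = concatMap (F₂-block j) (others j)

  F₂-list : List (Vec ℕ d)
  F₂-list = concatMap F₂-row (allFin d)

  F-list : List (Vec ℕ d)
  F-list = F₁-list ++ F₂-list ++ unitPairSums d ++ unitTripleSums d

  ∈-F₁-list⁺ : ∀ {x} → F₁ G x → x ∈ F₁-list
  ∈-F₁-list⁺ (i , n , gn , refl) =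
    ∈-concatMap⁺′ (λ i → map (_· 𝐞 i) (LG i)) (∈-allFin i) (∈-map⁺ (_· 𝐞 i) (proj₁ (proj₂ (LG-enum i)) n gn))

  ∈-F₁-list⁻ : ∀ {x} → x ∈ F₁-list → F₁ G x
  ∈-F₁-list⁻ x∈ with ∈-concatMap⁻′ (λ i → map (_· 𝐞 i) (LG i)) (allFin d) x∈
  ... | i , _ , x∈i with ∈-map⁻ (_· 𝐞 i) x∈i
  ...   | n , n∈ , refl = i , n , proj₂ (proj₂ (LG-enum i)) n n∈ , refl

  ∈-F₂-row⁻ : ∀ {j x} → x ∈ F₂-row j → ∃[ i ] ∃[ h ] (i ≢ j × 2 ≤ h × h ≤ m j × x ≡ 𝐞 i ⊕ h · 𝐞 j)
  ∈-F₂-row⁻ {j} x∈ with ∈-concatMap⁻′ (F₂-block j) (others j) x∈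
  ... | i , i∈ , x∈ji with ∈-map⁻ (λ h → 𝐞 i ⊕ h · 𝐞 j) x∈ji
  ...   | h , h∈ , refl = i , h , ∈-others⁻ i∈ , proj₁ (∈-range⁻ h∈) , proj₂ (∈-range⁻ h∈) , refl

  ∈-F₂-list⁺ : ∀ {x} → F₂ m x → x ∈ F₂-list
  ∈-F₂-list⁺ (i , j , h , i≢j , 2≤h , h≤m , refl) =
    ∈-concatMap⁺′ F₂-row (∈-allFin j) (∈-concatMap⁺′ (F₂-block j) (∈-others⁺ i≢j)
      (∈-map⁺ (λ h → 𝐞 i ⊕ h · 𝐞 j) (∈-range⁺ 2≤h h≤m)))

  ∈-F₂-list⁻ : ∀ {x} → x ∈ F₂-list → F₂ m x
  ∈-F₂-list⁻ x∈ with ∈-concatMap⁻′ F₂-row (allFin d) x∈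
  ... | j , _ , x∈j with ∈-F₂-row⁻ x∈j
  ...   | i , h , p = i , j , h , p

  ∈-F-list⁺ : ∀ {x} → F x → x ∈ F-list
  ∈-F-list⁺ (inj₁ f)               = ∈-++⁺ˡ (∈-F₁-list⁺ f)
  ∈-F-list⁺ (inj₂ (inj₁ f))        = ∈-++⁺ʳ F₁-list (∈-++⁺ˡ (∈-F₂-list⁺ f))
  ∈-F-list⁺ (inj₂ (inj₂ (inj₁ f))) = ∈-++⁺ʳ F₁-list (∈-++⁺ʳ F₂-list (∈-++⁺ˡ (∈-unitPairSums⁺ f)))
  ∈-F-list⁺ (inj₂ (inj₂ (inj₂ f))) =
    ∈-++⁺ʳ F₁-list (∈-++⁺ʳ F₂-list (∈-++⁺ʳ (unitPairSums d) (∈-unitTripleSums⁺ f)))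

  ∈-unitSums⁻ : ∀ {x} → x ∈ unitPairSums d ++ unitTripleSums d → F₃ x ⊎ F₄ x
  ∈-unitSums⁻ = Sum.map ∈-unitPairSums⁻ ∈-unitTripleSums⁻ ∘ ∈-++⁻ (unitPairSums d)

  ∈-F₂₃₄-lists⁻ : ∀ {x} → x ∈ F₂-list ++ unitPairSums d ++ unitTripleSums d → F₂ m x ⊎ F₃ x ⊎ F₄ x
  ∈-F₂₃₄-lists⁻ = Sum.map ∈-F₂-list⁻ ∈-unitSums⁻ ∘ ∈-++⁻ F₂-list

  ∈-F-list⁻ : ∀ {x} → x ∈ F-list → F x
  ∈-F-list⁻ = Sum.map ∈-F₁-list⁻ ∈-F₂₃₄-lists⁻ ∘ ∈-++⁻ F₁-list

  range-unique : ∀ j → Unique (range j)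
  range-unique j = UP.applyUpTo⁺₁ (2 +_) (m j ∸ 1) (λ i<j _ → <⇒≢ i<j ∘ +-cancelˡ-≡ 2 _ _)

  F₁-list-unique : Unique F₁-list
  F₁-list-unique =
    concatMap⁺ _ (UP.allFin⁺ d) (λ {i} _ → UP.map⁺ (·𝐞-injective i) (proj₁ (LG-enum i))) disjoint
    where
    disjoint : ∀ {i i′} → i ∈ allFin d → i′ ∈ allFin d → i ≢ i′ →
               Disjoint (map (_· 𝐞 i) (LG i)) (map (_· 𝐞 i′) (LG i′))
    disjoint {i} {i′} _ _ i≢i′ (x∈ , x∈′) with ∈-map⁻ (_· 𝐞 i) x∈ | ∈-map⁻ (_· 𝐞 i′) x∈′
    ... | n , n∈ , refl | n′ , _ , eq = G-≢0 (proj₂ (proj₂ (LG-enum i)) n n∈)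
      (trans (sym (lookup-·𝐞-≡ n i)) (trans (cong (λ v → lookup v i) eq) (lookup-·𝐞-≢ n′ i≢i′)))

  F₂-row-unique : ∀ j → Unique (F₂-row j)
  F₂-row-unique j =
    concatMap⁺ (F₂-block j) (others-unique j) (λ _ → UP.map⁺ 𝐞⊕·𝐞-injective (range-unique j)) disjoint
    where
    disjoint : ∀ {i i′} → i ∈ others j → i′ ∈ others j → i ≢ i′ → Disjoint (F₂-block j i) (F₂-block j i′)
    disjoint {i} {i′} i∈ _ i≢i′ (x∈ , x∈′)
      with ∈-map⁻ (λ h → 𝐞 i ⊕ h · 𝐞 j) x∈ | ∈-map⁻ (λ h → 𝐞 i′ ⊕ h · 𝐞 j) x∈′
    ... | h , _ , refl | h′ , _ , eq = 1+n≢0 (trans (sym (lookup-𝐞⊕·𝐞-≡ˡ (∈-others⁻ i∈) h))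
      (trans (cong (λ v → lookup v i) eq) (lookup-𝐞⊕·𝐞-≢ h′ i≢i′ (∈-others⁻ i∈))))

  F₂-list-unique : Unique F₂-list
  F₂-list-unique = concatMap⁺ F₂-row (UP.allFin⁺ d) (λ {j} _ → F₂-row-unique j) disjoint
    where
    -- the j-th coordinate is h ≥ 2 in row j but at most 1 in any other row
    disjoint : ∀ {j j′} → j ∈ allFin d → j′ ∈ allFin d → j ≢ j′ → Disjoint (F₂-row j) (F₂-row j′)
    disjoint {j} {j′} _ _ j≢j′ (x∈ , x∈′) with ∈-F₂-row⁻ x∈ | ∈-F₂-row⁻ x∈′
    ... | i , h , i≢j , 2≤h , _ , refl | i′ , h′ , _ , _ , _ , eq = <-irrefl refl (begin
      2                            ≤⟨ 2≤h ⟩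
      h                            ≡⟨ lookup-𝐞⊕·𝐞-≡ʳ i≢j h ⟨
      lookup (𝐞 i ⊕ h · 𝐞 j) j     ≡⟨ cong (λ v → lookup v j) eq ⟩
      lookup (𝐞 i′ ⊕ h′ · 𝐞 j′) j  ≤⟨ lookup-𝐞⊕·𝐞≤1 h′ j≢j′ ⟩
      1                            ∎)
      where open ≤-Reasoning

  F-list-unique : Unique F-list
  F-list-unique =
    UP.++⁺ F₁-list-unique
      (UP.++⁺ F₂-list-unique (UP.++⁺ (unitPairSums-unique d) (unitTripleSums-unique d) F₃-F₄-disjoint) F₂-F₃₄-disjoint)
      F₁-F₂₃₄-disjoint
    where
    coordinates≤1 : ∀ {x} → F₃ x ⊎ F₄ x → ∀ t → lookup x t ≤ 1
    coordinates≤1 (inj₁ (i , j , i<j , refl)) = lookup-𝐞⊕𝐞≤1 (FP.<⇒≢ i<j)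
    coordinates≤1 (inj₂ (i , j , k , i<j , j<k , refl)) =
      lookup-𝐞⊕𝐞⊕𝐞≤1 (FP.<⇒≢ i<j) (FP.<⇒≢ (FP.<-trans i<j j<k) ∘ sym) (FP.<⇒≢ j<k ∘ sym)
    F₁-F₂₃₄-disjoint : Disjoint F₁-list (F₂-list ++ unitPairSums d ++ unitTripleSums d)
    F₁-F₂₃₄-disjoint (x∈₁ , x∈₂₃₄) with ∈-F₁-list⁻ x∈₁
    ... | i , n , _ , refl = ·𝐞-not-spread n (F-spread (∈-F₂₃₄-lists⁻ x∈₂₃₄))
    F₂-F₃₄-disjoint : Disjoint F₂-list (unitPairSums d ++ unitTripleSums d)
    F₂-F₃₄-disjoint (x∈₂ , x∈₃₄) with ∈-F₂-list⁻ x∈₂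
    ... | i , j , h , i≢j , 2≤h , _ , refl =
      <-irrefl refl (≤-trans 2≤h (subst (_≤ 1) (lookup-𝐞⊕·𝐞-≡ʳ i≢j h) (coordinates≤1 (∈-unitSums⁻ x∈₃₄) j)))
    F₃-F₄-disjoint : Disjoint (unitPairSums d) (unitTripleSums d)
    F₃-F₄-disjoint (x∈₃ , x∈₄) with ∈-unitPairSums⁻ x∈₃ | ∈-unitTripleSums⁻ x∈₄
    ... | i , j , _ , refl | i′ , j′ , k′ , _ , _ , eq =
      1+n≢n (trans (sym (∣𝐞⊕𝐞⊕𝐞∣ i′ j′ k′)) (trans (cong ∣_∣ (sym eq)) (∣𝐞⊕𝐞∣ i j)))

  length-F₂-row : ∀ j → length (F₂-row j) ≡ (d ∸ 1) * (m j ∸ 1)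
  length-F₂-row j = begin
    length (F₂-row j)                            ≡⟨ length-concatMap (F₂-block j) (others j) ⟩
    sum (map (length ∘ F₂-block j) (others j))   ≡⟨ cong sum (LP.map-cong length-block (others j)) ⟩
    sum (map (λ _ → m j ∸ 1) (others j))         ≡⟨ sum-map-const (m j ∸ 1) (others j) ⟩
    length (others j) * (m j ∸ 1)                ≡⟨ cong (_* (m j ∸ 1)) (length-others j) ⟩
    (d ∸ 1) * (m j ∸ 1)                          ∎
    where
    open ≡-Reasoning
    length-block : ∀ i → length (F₂-block j i) ≡ m j ∸ 1
    length-block i =
      trans (LP.length-map (λ h → 𝐞 i ⊕ h · 𝐞 j) (range j)) (LP.length-applyUpTo (2 +_) (m j ∸ 1))

  length-F-list : length F-list ≡ sum (map (λ i → length (LG i)) (allFin d))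
                                 + (d ∸ 1) * sum (map (λ i → m i ∸ 1) (allFin d)) + d C 2 + d C 3
  length-F-list = begin
    length (F₁-list ++ F₂-list ++ unitPairSums d ++ unitTripleSums d)
      ≡⟨ LP.length-++ F₁-list ⟩
    length F₁-list + length (F₂-list ++ unitPairSums d ++ unitTripleSums d)
      ≡⟨ cong (length F₁-list +_)
              (trans (LP.length-++ F₂-list) (cong (length F₂-list +_) (LP.length-++ (unitPairSums d)))) ⟩
    length F₁-list + (length F₂-list + (length (unitPairSums d) + length (unitTripleSums d)))
      ≡⟨ cong₂ (λ a b → a + (b + _)) length-F₁-list length-F₂-list ⟩
    a₁ + (a₂ + (length (unitPairSums d) + length (unitTripleSums d)))
      ≡⟨ cong (λ n → a₁ + (a₂ + n)) (cong₂ _+_ (length-unitPairSums d) (length-unitTripleSums d)) ⟩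
    a₁ + (a₂ + (d C 2 + d C 3))
      ≡⟨ trans (sym (+-assoc a₁ a₂ _)) (sym (+-assoc (a₁ + a₂) (d C 2) (d C 3))) ⟩
    a₁ + a₂ + d C 2 + d C 3 ∎
    where
    open ≡-Reasoning
    a₁ = sum (map (λ i → length (LG i)) (allFin d))
    a₂ = (d ∸ 1) * sum (map (λ i → m i ∸ 1) (allFin d))
    length-F₁-list : length F₁-list ≡ a₁
    length-F₁-list = trans (length-concatMap (λ i → map (_· 𝐞 i) (LG i)) (allFin d))
                           (cong sum (LP.map-cong (λ i → LP.length-map (_· 𝐞 i) (LG i)) (allFin d)))
    length-F₂-list : length F₂-list ≡ a₂
    length-F₂-list = trans (length-concatMap F₂-row (allFin d))
                           (trans (cong sum (LP.map-cong length-F₂-row (allFin d)))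
                                  (sum-map-*ˡ (d ∸ 1) (λ i → m i ∸ 1) (allFin d)))

  minimal-system-size : ∀ (G′ : Vec ℕ d → Set) (L : List (Vec ℕ d)) →
                        GenV.IsMinimalSystemOfGenerators d G′ (Axis S) → Enumerates L G′ →
                        length L ≡ sum (map (λ i → length (LG i)) (allFin d))
                                   + (d ∸ 1) * sum (map (λ i → m i ∸ 1) (allFin d)) + d C 2 + d C 3
  minimal-system-size G′ L G′-minimal (L! , G′⊆L , L⊆G′)
    with ⊕-Generation.minimal-systems-unique d F-generates F-irreducible G′-minimal
  ... | F⊆G′ , G′⊆F = trans (enumerations-length L-enumerates-F F-list-enumerates) length-F-list
    where
    L-enumerates-F : Enumerates L F
    L-enumerates-F = L! , (λ x → G′⊆L x ∘ F⊆G′ x) , (λ x → G′⊆F x ∘ L⊆G′ x)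
    F-list-enumerates : Enumerates F-list F
    F-list-enumerates = F-list-unique , (λ _ → ∈-F-list⁺) , (λ _ → ∈-F-list⁻)

proposition5p2 : (d : ℕ) → 1 ≤ d →
    (S : Fin d → ℕ → Set) → (∀ i → IsNumericalSemigroup (S i)) →
    (∀ i → ∃[ n ] ¬ S i n) →
    (m : Fin d → ℕ) → (∀ i → IsMultiplicity (S i) (m i)) →
    (G : Fin d → ℕ → Set) → (∀ i → GenN.IsMinimalSystemOfGenerators (G i) (S i)) →
    (LG : Fin d → List ℕ) → (∀ i → Enumerates (LG i) (G i)) →
    GenV.IsMinimalSystemOfGenerators d
      (λ x → F₁ G x ⊎ F₂ m x ⊎ F₃ x ⊎ F₄ x) (Axis S)
    × (∀ (G′ : Vec ℕ d → Set) (L : List (Vec ℕ d)) →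
         GenV.IsMinimalSystemOfGenerators d G′ (Axis S) → Enumerates L G′ →
         length L ≡ sum (map (λ i → length (LG i)) (allFin d))
                    + (d ∸ 1) * sum (map (λ i → m i ∸ 1) (allFin d))
                    + d C 2 + d C 3)
-- The argument covers d = 0 as well.
proposition5p2 d _ S S-ns S-proper m m-mult G G-min LG LG-enum =
  F-minimal , minimal-system-size
  where open MinimalSystemOfAxis S S-ns S-proper m m-mult G G-min LG LG-enum
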